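{- Let $X$ be a set and let $\mathcal{L}=\{L_x \mid x\in X\}$ be a family of constraint satisfaction problems whose solution sets are pairwise disjoint (i.e. for $x\neq y$ no object is a solution of both $L_x$ and $L_y$). Let $\mathcal{T}$ be a set containing every solution of every $L_x$, $x\in X$. Let $G$ be a group and let $\phi:\mathcal{T}\times G\to\mathcal{T}$, $(T,g)\mapsto T^g$, be a (right) action of $G$ on $\mathcal{T}$ which maps solutions to solutions (if $T$ is a solution of some CSP in $\mathcal{L}$, then so is $T^g$ for every $g\in G$). Let $\psi:\mathcal{T}\to X$ be a surjective function. Assume that (a) every solution $T$ of one of the CSPs in $\mathcal{L}$ is a solution of $L_{\psi(T)}$, and (b) $\phi$ induces an action of $G$ on $X$, that is, setting $x^g:=\psi(T^g)$ for $x=\psi(T)$ is well-defined (independent of the choice of $T\in\psi^{ -1}(x)$), so that $\psi(T^g)=\psi(T)^g$ for all $T\in\mathcal{T}$, $g\in G$. Call two elements of $\mathcal{T}$ (respectively of $X$) equivalent if they lie in the same $G$-orbit under $\phi$ (respectively under the induced action). Then: (i) If $Y\subseteq X$ contains at least one element of every orbit of $X$ under the induced action, then the solutions of the CSPs in $\{L_y\mid y\in Y\}$ contain at least one element from every $G$-orbit of solutions (of CSPs in $\mathcal{L}$) under $\phi$. (ii) If $S$ is a solution of $L_x$ and $T$ is a solution of $L_y$ and $S$ is equivalent to $T$, then $x$ is equivalent to $y$. (iii) If $T$ is a solution of $L_x$, then the set of solutions of $L_x$ that are equivalent to $T$ equals the orbit of $T$ under the stabiliser of $x$ in $G$ (with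 respect to the induced action on $X$).
   Context: A constraint satisfaction problem (CSP) is a triple $(V,D,C)$ consisting of a finite set $V$ of variables, a finite set $D$ (the domain) of values, and a set $C$ of constraints, each constraint being a subset of the set of all functions $V\to D$. A solution of the CSP is a function $h:V\to D$ lying in every constraint of $C$. -}

module Defs where

open import Level using (0ℓ)
open import Data.Nat using (ℕ)
open import Data.Fin using (Fin)
open import Data.List using (List; []; _∷_)
open import Data.Unit using (⊤)
open import Data.Product using (Σ; ∃; ∃-syntax; _×_; _,_; proj₁; proj₂)
open import Relation.Binary.PropositionalEquality using (_≡_)
open import Relation.Unary using (Pred)
open import Algebra.Bundles using (Group)

-- A CSP with variable set V = Fin n and domain D = Fin m.
Assignment : ℕ → ℕ → Set
Assignment n m = Fin n → Fin m

Constraint : ℕ → ℕ → Set₁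
Constraint n m = Pred (Assignment n m) 0ℓ

record CSP (n m : ℕ) : Set₁ where
  field
    constraints : List (Constraint n m)

-- h is a solution of L: h lies in every constraint of L.
-- (written by recursion on the list, i.e. All (λ c → c h) C, but landing in Set)
satisfiesAll : ∀ {n m} → List (Constraint n m) → Assignment n m → Set
satisfiesAll []       h = ⊤
satisfiesAll (c ∷ cs) h = c h × satisfiesAll cs h

IsSolution : ∀ {n m} → CSP n m → Assignment n m → Set
IsSolution L h = satisfiesAll (CSP.constraints L) h

record Setup : Set₁ where
  field
    n m : ℕ
    X : Set
    L : X → CSP n m
    disjoint : ∀ x y (h : Assignment n m) →
               IsSolution (L x) h → IsSolution (L y) h → x ≡ y
    𝒯 : Pred (Assignment n m) 0ℓ
    𝒯-isSubset : ∀ h (p q : 𝒯 h) → p ≡ q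
    𝒯-contains : ∀ x h → IsSolution (L x) h → 𝒯 h
    G : Group 0ℓ 0ℓ
  El𝒯 : Set
  El𝒯 = Σ (Assignment n m) 𝒯
  val : El𝒯 → Assignment n m
  val = proj₁
  open Group G using (Carrier; _≈_; _∙_; ε)
  IsSol : El𝒯 → Set
  IsSol T = ∃[ x ] IsSolution (L x) (val T)
  field
    φ : El𝒯 → Carrier → El𝒯
    φ-identity : ∀ T → φ T ε ≡ T
    φ-compose  : ∀ T g h → φ (φ T g) h ≡ φ T (g ∙ h)
    φ-cong     : ∀ T {g h} → g ≈ h → φ T g ≡ φ T h
    φ-sol : ∀ T g → IsSol T → IsSol (φ T g)
    ψ : El𝒯 → X
    ψ-surj : ∀ x → ∃[ T ] ψ T ≡ x
    hyp-a : ∀ T x → IsSolution (L x) (val T) → IsSolution (L (ψ T)) (val T)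
    hyp-b : ∀ S T g → ψ S ≡ ψ T → ψ (φ S g) ≡ ψ (φ T g)

  _^X_ : X → Carrier → X
  x ^X g = ψ (φ (proj₁ (ψ-surj x)) g)

  _~𝒯_ : El𝒯 → El𝒯 → Set
  S ~𝒯 T = ∃[ g ] φ S g ≡ T

  _~X_ : X → X → Set
  x ~X y = ∃[ g ] x ^X g ≡ y

  Stab : X → Pred Carrier 0ℓ
  Stab x g = x ^X g ≡ x

  PartI : Set₁
  PartI = (Y : Pred X 0ℓ) → (∀ x → ∃[ y ] (Y y × x ~X y)) →
          ∀ T → IsSol T →
          ∃[ y ] (Y y × ∃[ S ] (IsSolution (L y) (val S) × S ~𝒯 T))

  PartII : Set
  PartII = ∀ x y S T → IsSolution (L x) (val S) → IsSolution (L y) (val T) →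
           S ~𝒯 T → x ~X y

  PartIII : Set
  PartIII = ∀ x T → IsSolution (L x) (val T) → ∀ S →
            ((IsSolution (L x) (val S) × S ~𝒯 T) →
               ∃[ g ] (Stab x g × φ T g ≡ S))
            × ((∃[ g ] (Stab x g × φ T g ≡ S)) →
               (IsSolution (L x) (val S) × S ~𝒯 T))

-- A solution of L x has index ψ T = x (by (a) and disjointness), and ψ is
-- G-equivariant by (b). Hence ψ maps each G-orbit of solutions into a
-- G-orbit of X, an element g moving a solution of L x to a solution of L y
-- moves x to y, and g keeps a solution of L x inside L x exactly when g fixes x.
module Submission where

open import Defs
open import Data.Product using (_×_; _,_; ∃-syntax)
open import Relation.Binary.PropositionalEquality
  using (_≡_; refl; sym; trans; cong; subst; module ≡-Reasoning)
open import Algebra.Bundles using (Group)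

module _ (𝒮 : Setup) where
  open Setup 𝒮
  open Group G using (_∙_; ε; _⁻¹; inverseʳ)
  open ≡-Reasoning

  ψ-equivariant : ∀ T g → ψ (φ T g) ≡ ψ T ^X g
  ψ-equivariant T g with ψ-surj (ψ T)
  ... | R , ψR≡ψT = hyp-b T R g (sym ψR≡ψT)

  ψ-solution : ∀ {x} T → IsSolution (L x) (val T) → ψ T ≡ x
  ψ-solution {x} T s = sym (disjoint x (ψ T) (val T) s (hyp-a T x s))

  φ-inverse : ∀ T g → φ (φ T g) (g ⁻¹) ≡ T
  φ-inverse T g = begin
    φ (φ T g) (g ⁻¹) ≡⟨ φ-compose T g (g ⁻¹) ⟩
    φ T (g ∙ g ⁻¹)   ≡⟨ φ-cong T (inverseʳ g) ⟩
    φ T ε            ≡⟨ φ-identity T ⟩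
    T                ∎

  ~𝒯-sym : ∀ {S T} → S ~𝒯 T → T ~𝒯 S
  ~𝒯-sym {S} (g , refl) = g ⁻¹ , φ-inverse S g

  φ-solution : ∀ {x} T g → IsSolution (L x) (val T) →
               IsSolution (L (x ^X g)) (val (φ T g))
  φ-solution {x} T g s with φ-sol T g (x , s)
  ... | z , s′ = subst (λ w → IsSolution (L w) (val (φ T g))) ψφT≡x^g
                       (hyp-a (φ T g) z s′)
    where
    ψφT≡x^g : ψ (φ T g) ≡ x ^X g
    ψφT≡x^g = trans (ψ-equivariant T g) (cong (_^X g) (ψ-solution T s))

  ^X-solution : ∀ {x y} S T g → IsSolution (L x) (val S) →
                IsSolution (L y) (val T) → φ S g ≡ T → x ^X g ≡ y
  ^X-solution {x} {y} S T g sS sT φSg≡T = begin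
    x ^X g      ≡⟨ cong (_^X g) (ψ-solution S sS) ⟨
    ψ S ^X g    ≡⟨ ψ-equivariant S g ⟨
    ψ (φ S g)   ≡⟨ cong ψ φSg≡T ⟩
    ψ T         ≡⟨ ψ-solution T sT ⟩
    y           ∎

  partI : PartI
  partI Y covers T (z , sT) with covers (ψ T)
  ... | y , Yy , g , ψT^g≡y =
    y , Yy , φ T g , sφTg , ~𝒯-sym (g , refl)
    where
    sφTg : IsSolution (L y) (val (φ T g))
    sφTg = subst (λ w → IsSolution (L w) (val (φ T g))) ψT^g≡y
                 (φ-solution T g (hyp-a T z sT))

  partII : PartII
  partII x y S T sS sT (g , φSg≡T) = g , ^X-solution S T g sS sT φSg≡T

  partIII : PartIII
  partIII x T sT S = equivalent⇒stabiliser , stabiliser⇒equivalent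
    where
    equivalent⇒stabiliser : IsSolution (L x) (val S) × S ~𝒯 T →
                            ∃[ g ] (Stab x g × φ T g ≡ S)
    equivalent⇒stabiliser (sS , S~T) with ~𝒯-sym S~T
    ... | g , φTg≡S = g , ^X-solution T S g sT sS φTg≡S , φTg≡S

    stabiliser⇒equivalent : ∃[ g ] (Stab x g × φ T g ≡ S) →
                            IsSolution (L x) (val S) × S ~𝒯 T
    stabiliser⇒equivalent (g , x^g≡x , refl) =
      subst (λ w → IsSolution (L w) (val (φ T g))) x^g≡x (φ-solution T g sT)
      , ~𝒯-sym (g , refl)

lemma1 : (𝒮 : Setup) → Setup.PartI 𝒮 × Setup.PartII 𝒮 × Setup.PartIII 𝒮
lemma1 𝒮 = partI 𝒮 , partII 𝒮 , partIII 𝒮
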